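{- Let $G$ be a graph and let $H$ be a connected induced subgraph of $G$ such that every edge of $G$ incident to a vertex of $H$ is a cut-edge of $G$. Then every vertex of $H$ either has degree $1$ or is not contained in any minimum MEG-set of $G$.
   Context: All graphs are finite and simple. A cut-edge of $G$ is an edge $e$ such that $G-e$ has more connected components than $G$. A pair of vertices $u,v$ (or any vertex set containing them) monitors an edge $e$ if $e$ lies on every shortest $u$–$v$ path. A monitoring edge-geodetic set (MEG-set) of $G$ is a set $M\subseteq V(G)$ such that every edge of $G$ is monitored by some pair of vertices of $M$; a minimum MEG-set is one of smallest size. -}

module Defs where

open import Data.Nat using (ℕ; zero; suc; _≤_; _<_)
open import Data.Fin using (Fin)
open import Data.Fin.Properties using (_≟_)
open import Data.Fin.Subset using (Subset; _∈_; _∉_; ∣_∣)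
open import Data.Vec using (tabulate)
open import Data.Bool using (Bool; true; false; _∧_; _∨_; not)
open import Data.Product using (Σ; ∃; _×_; _,_)
open import Data.Sum using (_⊎_)
open import Relation.Binary.PropositionalEquality using (_≡_)
open import Relation.Nullary.Decidable using (⌊_⌋)
open import Function.Definitions using (Surjective)

Adj : ℕ → Set
Adj n = Fin n → Fin n → Bool

record Graph (n : ℕ) : Set where
  field
    adj    : Adj n
    sym    : ∀ x y → adj x y ≡ adj y x
    irrefl : ∀ x → adj x x ≡ false
open Graph public

data Walk {n : ℕ} (A : Adj n) : Fin n → Fin n → Set where
  []  : ∀ {u} → Walk A u u
  _∷_ : ∀ {u w v} → A u w ≡ true → Walk A w v → Walk A u v

len : ∀ {n} {A : Adj n} {u v} → Walk A u v → ℕ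
len [] = 0
len (_ ∷ p) = suc (len p)

data EdgeOn {n : ℕ} {A : Adj n} (x y : Fin n) : ∀ {u v} → Walk A u v → Set where
  here₁ : ∀ {v} (e : A x y ≡ true) (p : Walk A y v) → EdgeOn x y (e ∷ p)
  here₂ : ∀ {v} (e : A y x ≡ true) (p : Walk A x v) → EdgeOn x y (e ∷ p)
  there : ∀ {u w v} (e : A u w ≡ true) {p : Walk A w v} → EdgeOn x y p → EdgeOn x y (e ∷ p)

data AllIn {n : ℕ} {A : Adj n} (S : Subset n) : ∀ {u v} → Walk A u v → Set where
  []  : ∀ {u} → u ∈ S → AllIn S ([] {u = u})
  _∷_ : ∀ {u w v} {e : A u w ≡ true} {p : Walk A w v} → u ∈ S → AllIn S p → AllIn S (e ∷ p)

Connected : ∀ {n} → Adj n → Fin n → Fin n → Set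
Connected A u v = Walk A u v

-- A shortest u–v walk (equivalently, a shortest u–v path).
IsShortest : ∀ {n} {A : Adj n} {u v} → Walk A u v → Set
IsShortest {A = A} {u} {v} p = ∀ (q : Walk A u v) → len p ≤ len q

-- The number of connected components of (Fin n, A) is k:
-- there is a surjection onto Fin k identifying exactly the connected pairs.
NumComponents : ∀ {n} → Adj n → ℕ → Set
NumComponents {n} A k =
  Σ (Fin n → Fin k) λ f → Surjective _≡_ _≡_ f ×
    (∀ u v → (f u ≡ f v → Connected A u v) × (Connected A u v → f u ≡ f v))

removeEdge : ∀ {n} → Adj n → Fin n → Fin n → Adj n
removeEdge A x y a b =
  A a b ∧ not ((⌊ a ≟ x ⌋ ∧ ⌊ b ≟ y ⌋) ∨ (⌊ a ≟ y ⌋ ∧ ⌊ b ≟ x ⌋))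

CutEdge : ∀ {n} → Graph n → Fin n → Fin n → Set
CutEdge G x y = adj G x y ≡ true ×
  (∀ k k' → NumComponents (adj G) k → NumComponents (removeEdge (adj G) x y) k' → k < k')

Monitors : ∀ {n} → Graph n → Fin n → Fin n → Fin n → Fin n → Set
Monitors G u v x y = Connected (adj G) u v ×
  (∀ (p : Walk (adj G) u v) → IsShortest p → EdgeOn x y p)

IsMEG : ∀ {n} → Graph n → Subset n → Set
IsMEG G M = ∀ x y → adj G x y ≡ true →
  Σ _ λ u → Σ _ λ v → u ∈ M × v ∈ M × Monitors G u v x y

IsMinimumMEG : ∀ {n} → Graph n → Subset n → Set
IsMinimumMEG G M = IsMEG G M × (∀ M' → IsMEG G M' → ∣ M ∣ ≤ ∣ M' ∣)

degree : ∀ {n} → Graph n → Fin n → ℕ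
degree G v = ∣ tabulate (adj G v) ∣

InducedConnected : ∀ {n} → Graph n → Subset n → Set
InducedConnected G S = ∀ u v → u ∈ S → v ∈ S →
  Σ (Walk (adj G) u v) λ p → AllIn S p

{-# OPTIONS --safe #-}
-- Let v ∈ M have degree ≠ 1 with only cut-edges at v; we show that M − v is still an MEG-set.
-- If (v, w) monitors an edge, a shortest v–w walk leaves v along an edge va, and v has another
-- neighbour b. As vb is a bridge, w stays on v's side of G − vb, whereas one vertex u of the pair
-- in M monitoring vb lies on b's side: a shortest walk through a bridge has its ends on opposite
-- sides. Hence every u–w walk passes through v, so every shortest u–w walk ends in a shortest
-- v–w walk, which carries the edge, and (u, w) monitors it as well.
module Submission where

open import Defs
open import Data.Nat using (ℕ; zero; suc; _+_; _≤_; _<_)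
open import Data.Nat.Properties
  using (<-irrefl; <⇒≱; ≮⇒≥; n<1+n; m<1+n⇒m<n∨m≡n;
         m≤m+n; m≤n+m; +-comm; +-monoˡ-≤; +-monoʳ-≤; +-monoʳ-<; +-cancelˡ-≤; module ≤-Reasoning)
  renaming (_≟_ to _≟ℕ_)
open import Data.Fin using (Fin; zero; suc)
open import Data.Fin.Properties using (_≟_; any?; suc-injective)
open import Data.Fin.Subset using (Subset; _∈_; _∉_; ∣_∣; _⊆_; ⁅_⁆; _-_)
open import Data.Fin.Subset.Properties
  using (⊆-antisym; x∈⁅x⁆; x∈⁅y⁆⇒x≡y; ∣⁅x⁆∣≡1; x∈p∧x≢y⇒x∈p-y; x∈p⇒∣p-x∣<∣p∣)
open import Data.Vec using (tabulate)
open import Data.Vec.Properties using (lookup∘tabulate; lookup⇒[]=; []=⇒lookup)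
import Data.Vec.Functional as Vector
open import Data.Bool using (Bool; true; _∧_; _∨_; not)
open import Data.Bool.Properties using (∧-conicalˡ) renaming (_≟_ to _≟ᵇ_)
open import Data.Sum using (_⊎_; inj₁; inj₂; [_,_])
import Data.Sum as Sum
import Data.Product as Product
open import Data.Product using (Σ; ∃; _×_; _,_; proj₁; proj₂)
open import Function using (id; _∘_; _⇔_; mk⇔)
open import Function.Definitions using (Surjective)
open import Function.Consequences.Propositional using (strictlySurjective⇒surjective)
open import Relation.Binary.Structures using (IsEquivalence)
open import Relation.Binary.PropositionalEquality
  using (_≡_; _≢_; refl; trans; cong; cong₂; subst; subst₂) renaming (sym to ≡-sym)
open import Relation.Nullary using (¬_; Dec; yes; no; does; contradiction; ¬?; _×-dec_; _⊎-dec_)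
open import Relation.Nullary.Decidable using (map′; dec-false; does-⇔; isYes≗does; decidable-stable)
open import Relation.Nullary.Decidable.Core using (¬¬-excluded-middle)
open import Relation.Nullary.Negation using (¬¬-Monad)
open import Relation.Unary using (Decidable)
open import Effect.Monad using (RawMonad)
open import Level using (0ℓ)

open RawMonad (¬¬-Monad {0ℓ}) using (pure; _>>=_)

private
  variable
    n : ℕ
    A : Adj n
    a b c d u v w x y : Fin n

IsLeast : (ℕ → Set) → ℕ → Set
IsLeast P k = P k × (∀ {j} → j < k → ¬ P j)

least-solution : {P : ℕ → Set} → Decidable P → ∀ {m} → P m → ∃ (IsLeast P)
least-solution {P} P? {m} pm =
  [ (λ none → contradiction pm (none (n<1+n m))) , id ] (search (suc m))
  where
  search : ∀ m → (∀ {j} → j < m → ¬ P j) ⊎ ∃ (IsLeast P)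
  search zero = inj₁ λ ()
  search (suc m) with search m | P? m
  ... | inj₂ least | _      = inj₂ least
  ... | inj₁ none  | yes pm = inj₂ (m , pm , none)
  ... | inj₁ none  | no ¬pm =
    inj₁ λ j<1+m → [ none , (λ { refl → ¬pm }) ] (m<1+n⇒m<n∨m≡n j<1+m)

Classification : (Fin n → Fin n → Set) → ℕ → Set
Classification {n} _∼_ k =
  Σ (Fin n → Fin k) λ f → Surjective _≡_ _≡_ f ×
    (∀ u v → (f u ≡ f v → u ∼ v) × (u ∼ v → f u ≡ f v))

module _ {_∼_ : Fin (suc n) → Fin (suc n) → Set} (∼-equiv : IsEquivalence _∼_) where
  open IsEquivalence ∼-equiv renaming (refl to ∼-refl; sym to ∼-sym; trans to ∼-trans)

  _∼⁺_ : Fin n → Fin n → Set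
  i ∼⁺ j = suc i ∼ suc j

  ∼⁺-equiv : IsEquivalence _∼⁺_
  ∼⁺-equiv = record { refl = ∼-refl ; sym = ∼-sym ; trans = ∼-trans }

  classification-join : ∀ {k} i → zero ∼ suc i →
    Classification _∼⁺_ k → Classification _∼_ k
  classification-join i 0∼i (f , f-onto , f-classifies) =
    f ∘ rep , strictlySurjective⇒surjective onto , classifies
    where
    rep : Fin (suc n) → Fin n
    rep = i Vector.∷ id

    rep-∼ : ∀ u → suc (rep u) ∼ u
    rep-∼ zero    = ∼-sym 0∼i
    rep-∼ (suc j) = ∼-refl

    onto : ∀ y → ∃ λ u → f (rep u) ≡ y
    onto y = suc (proj₁ (f-onto y)) , proj₂ (f-onto y) refl

    classifies : ∀ u v → (f (rep u) ≡ f (rep v) → u ∼ v) × (u ∼ v → f (rep u) ≡ f (rep v))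
    classifies u v =
      (λ eq → ∼-trans (∼-sym (rep-∼ u)) (∼-trans (proj₁ rep-classifies eq) (rep-∼ v))) ,
      (λ u∼v → proj₂ rep-classifies (∼-trans (rep-∼ u) (∼-trans u∼v (∼-sym (rep-∼ v)))))
      where
      rep-classifies = f-classifies (rep u) (rep v)

  classification-new : ∀ {k} → (∀ i → ¬ zero ∼ suc i) →
    Classification _∼⁺_ k → Classification _∼_ (suc k)
  classification-new {k} apart (f , f-onto , f-classifies) =
    g , strictlySurjective⇒surjective onto , classifies
    where
    g : Fin (suc n) → Fin (suc k)
    g = zero Vector.∷ (suc ∘ f)

    onto : ∀ y → ∃ λ u → g u ≡ y
    onto zero    = zero , refl
    onto (suc y) = suc (proj₁ (f-onto y)) , cong suc (proj₂ (f-onto y) refl)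

    classifies : ∀ u v → (g u ≡ g v → u ∼ v) × (u ∼ v → g u ≡ g v)
    classifies zero    zero    = (λ _ → ∼-refl) , (λ _ → refl)
    classifies zero    (suc j) = (λ ()) , (λ 0∼j → contradiction 0∼j (apart j))
    classifies (suc i) zero    = (λ ()) , (λ i∼0 → contradiction (∼-sym i∼0) (apart i))
    classifies (suc i) (suc j) =
      (λ eq → proj₁ (f-classifies i j) (suc-injective eq)) ,
      (λ i∼j → cong suc (proj₂ (f-classifies i j) i∼j))

classification : {_∼_ : Fin n → Fin n → Set} → IsEquivalence _∼_ → ¬ ¬ ∃ (Classification _∼_)
classification {zero}  _       = pure (0 , (λ ()) , (λ ()) , λ ())
classification {suc n} {_∼_} ∼-equiv =
  classification (∼⁺-equiv ∼-equiv) >>= λ (k , classes) →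
  ¬¬-excluded-middle {A = ∃ λ i → zero ∼ suc i} >>= λ where
    (yes (i , 0∼i)) → pure (k , classification-join ∼-equiv i 0∼i classes)
    (no apart)      →
      pure (suc k , classification-new ∼-equiv (λ i 0∼i → apart (i , 0∼i)) classes)

∣tabulate∣≡1 : (g : Fin n → Bool) → g x ≡ true → (∀ y → g y ≡ true → y ≡ x) →
  ∣ tabulate g ∣ ≡ 1
∣tabulate∣≡1 {x = x} g gx unique = trans (cong ∣_∣ (⊆-antisym ⊆⁅x⁆ ⁅x⁆⊆)) (∣⁅x⁆∣≡1 x)
  where
  ∈⇒true : ∀ {y} → y ∈ tabulate g → g y ≡ true
  ∈⇒true {y} y∈ = trans (≡-sym (lookup∘tabulate g y)) ([]=⇒lookup y∈)

  ⊆⁅x⁆ : tabulate g ⊆ ⁅ x ⁆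
  ⊆⁅x⁆ y∈ = subst (_∈ ⁅ x ⁆) (≡-sym (unique _ (∈⇒true y∈))) (x∈⁅x⁆ x)

  ⁅x⁆⊆ : ⁅ x ⁆ ⊆ tabulate g
  ⁅x⁆⊆ {y} y∈ = lookup⇒[]= y (tabulate g)
    (trans (lookup∘tabulate g y) (subst (λ z → g z ≡ true) (≡-sym (x∈⁅y⁆⇒x≡y x y∈)) gx))

∣tabulate∣≢1⇒another : (g : Fin n → Bool) → ∣ tabulate g ∣ ≢ 1 → g x ≡ true →
  ∃ λ y → g y ≡ true × y ≢ x
∣tabulate∣≢1⇒another {x = x} g size≢1 gx
  with any? (λ y → (g y ≟ᵇ true) ×-dec ¬? (y ≟ x))
... | yes another = another
... | no none = contradiction
  (∣tabulate∣≡1 g gx λ y gy → decidable-stable (y ≟ x) λ y≢x → none (y , gy , y≢x)) size≢1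

module _ {A : Adj n} where

  infixr 5 _++_
  _++_ : Walk A u v → Walk A v w → Walk A u w
  []      ++ q = q
  (e ∷ p) ++ q = e ∷ (p ++ q)

  len-++ : (p : Walk A u v) (q : Walk A v w) → len (p ++ q) ≡ len p + len q
  len-++ []      q = refl
  len-++ (e ∷ p) q = cong suc (len-++ p q)

  EdgeOn-++⁺ʳ : (p : Walk A u v) {q : Walk A v w} → EdgeOn x y q → EdgeOn x y (p ++ q)
  EdgeOn-++⁺ʳ []      on = on
  EdgeOn-++⁺ʳ (e ∷ p) on = there e (EdgeOn-++⁺ʳ p on)

  EdgeOn-++⁻ : (p : Walk A u v) {q : Walk A v w} → EdgeOn x y (p ++ q) →
    EdgeOn x y p ⊎ EdgeOn x y q
  EdgeOn-++⁻ []      on                   = inj₂ on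
  EdgeOn-++⁻ (e ∷ p) (here₁ .e .(p ++ _)) = inj₁ (here₁ e p)
  EdgeOn-++⁻ (e ∷ p) (here₂ .e .(p ++ _)) = inj₁ (here₂ e p)
  EdgeOn-++⁻ (e ∷ p) (there .e on)        = Sum.map₁ (there e) (EdgeOn-++⁻ p on)

  record PassesThrough (x : Fin n) (p : Walk A u w) : Set where
    constructor passes
    field
      before : Walk A u x
      after  : Walk A x w
      splits : p ≡ before ++ after

    len-splits : len p ≡ len before + len after
    len-splits = trans (cong len splits) (len-++ before after)

    len-before≤ : len before ≤ len p
    len-before≤ = subst (len before ≤_) (≡-sym len-splits) (m≤m+n (len before) (len after))

    len-after≤ : len after ≤ len p
    len-after≤ = subst (len after ≤_) (≡-sym len-splits) (m≤n+m (len after) (len before))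

  open PassesThrough public

  PassesThrough-∷ : (e : A u v ≡ true) {p : Walk A v w} → PassesThrough x p →
    PassesThrough x (e ∷ p)
  PassesThrough-∷ e (passes p q refl) = passes (e ∷ p) q refl

  IsShortest-≤ : {s : Walk A u w} → IsShortest s → (p : Walk A u v) (q : Walk A v w) →
    len s ≤ len p + len q
  IsShortest-≤ {s = s} s-shortest p q = subst (len s ≤_) (len-++ p q) (s-shortest (p ++ q))

  IsShortest-after : {s : Walk A u w} → IsShortest s → (π : PassesThrough x s) → IsShortest (after π)
  IsShortest-after s-shortest π q = +-cancelˡ-≤ (len (before π)) _ _
    (subst (_≤ len (before π) + len q) (len-splits π) (IsShortest-≤ s-shortest (before π) q))

  walk-of-length? : ∀ k u w → Dec (Σ (Walk A u w) λ p → len p ≡ k)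
  walk-of-length? zero u w =
    map′ (λ { refl → [] , refl }) (λ { ([] , _) → refl ; (_ ∷ _ , ()) }) (u ≟ w)
  walk-of-length? (suc k) u w =
    map′ (λ { (_ , e , p , refl) → e ∷ p , refl })
         (λ { ([] , ()) ; (e ∷ p , refl) → _ , e , p , refl })
      (any? λ a → (A u a ≟ᵇ true) ×-dec walk-of-length? k a w)

  shortest-walk : Walk A u w → Σ (Walk A u w) IsShortest
  shortest-walk {u} {w} p with least-solution (λ k → walk-of-length? k u w) (p , refl)
  ... | _ , (q , refl) , none-shorter = q , λ r → ≮⇒≥ λ r<q → none-shorter r<q (r , refl)

  record Crossing (x y : Fin n) (s : Walk A u w) : Set where
    constructor crossing
    field
      prefix : Walk A u x
      suffix : Walk A y w
      len-crossing : len prefix + suc (len suffix) ≡ len s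

  open Crossing public

  EdgeOn⇒Crossing : {s : Walk A u w} → EdgeOn x y s → Crossing x y s ⊎ Crossing y x s
  EdgeOn⇒Crossing (here₁ e p)  = inj₁ (crossing [] p refl)
  EdgeOn⇒Crossing (here₂ e p)  = inj₂ (crossing [] p refl)
  EdgeOn⇒Crossing (there e on) = Sum.map (Crossing-∷ e) (Crossing-∷ e) (EdgeOn⇒Crossing on)
    where
    Crossing-∷ : ∀ {a b} (e : A u v ≡ true) {s : Walk A v w} → Crossing a b s → Crossing a b (e ∷ s)
    Crossing-∷ e (crossing p q eq) = crossing (e ∷ p) q (cong suc eq)

  shortest-suffix-avoids : {s : Walk A u w} → IsShortest s → (cr : Crossing x y s) →
    ¬ PassesThrough x (suffix cr)
  shortest-suffix-avoids {s = s} s-shortest (crossing p q eq) π =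
    <⇒≱ shortcut (IsShortest-≤ s-shortest p (after π))
    where
    open ≤-Reasoning
    shortcut : len p + len (after π) < len s
    shortcut = begin-strict
      len p + len (after π) ≤⟨ +-monoʳ-≤ (len p) (len-after≤ π) ⟩
      len p + len q         <⟨ +-monoʳ-< (len p) (n<1+n (len q)) ⟩
      len p + suc (len q)   ≡⟨ eq ⟩
      len s                 ∎

  shortest-prefix-avoids : {s : Walk A u w} → IsShortest s → (cr : Crossing y x s) →
    ¬ PassesThrough x (prefix cr)
  shortest-prefix-avoids {s = s} s-shortest (crossing p q eq) π =
    <⇒≱ shortcut (IsShortest-≤ s-shortest (before π) q)
    where
    open ≤-Reasoning
    shortcut : len (before π) + len q < len s
    shortcut = begin-strict
      len (before π) + len q ≤⟨ +-monoˡ-≤ (len q) (len-before≤ π) ⟩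
      len p + len q          <⟨ +-monoʳ-< (len p) (n<1+n (len q)) ⟩
      len p + suc (len q)    ≡⟨ eq ⟩
      len s                  ∎

module _ {A : Adj n} (A-sym : ∀ x y → A x y ≡ A y x) where

  reverse : Walk A u w → Walk A w u
  reverse []      = []
  reverse (e ∷ p) = reverse p ++ (trans (A-sym _ _) e ∷ [])

  len-reverse : (p : Walk A u w) → len (reverse p) ≡ len p
  len-reverse []      = refl
  len-reverse (e ∷ p) = trans (len-++ (reverse p) _) (trans (+-comm _ 1) (cong suc (len-reverse p)))

  EdgeOn-reverse⁻ : (p : Walk A u w) → EdgeOn x y (reverse p) → EdgeOn x y p
  EdgeOn-reverse⁻ (e ∷ p) on with EdgeOn-++⁻ (reverse p) on
  ... | inj₁ on-p             = there e (EdgeOn-reverse⁻ p on-p)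
  ... | inj₂ (here₁ _ [])     = here₂ e p
  ... | inj₂ (here₂ _ [])     = here₁ e p
  ... | inj₂ (there _ ())

  IsShortest-reverse : {p : Walk A u w} → IsShortest p → IsShortest (reverse p)
  IsShortest-reverse {p = p} p-shortest q =
    subst₂ _≤_ (≡-sym (len-reverse p)) (len-reverse q) (p-shortest (reverse q))

SameEdge : Fin n → Fin n → Fin n → Fin n → Set
SameEdge x y a b = (a ≡ x × b ≡ y) ⊎ (a ≡ y × b ≡ x)

sameEdge? : (x y a b : Fin n) → Dec (SameEdge x y a b)
sameEdge? x y a b = (a ≟ x ×-dec b ≟ y) ⊎-dec (a ≟ y ×-dec b ≟ x)

SameEdge-swap : SameEdge x y a b ⇔ SameEdge x y b a
SameEdge-swap = mk⇔ swap swap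
  where
  swap : SameEdge x y a b → SameEdge x y b a
  swap = Sum.swap ∘ Sum.map Product.swap Product.swap

module _ {A : Adj n} {x y : Fin n} where

  removeEdge-unfold : ∀ a b → removeEdge A x y a b ≡ A a b ∧ not (does (sameEdge? x y a b))
  removeEdge-unfold a b = cong (λ same → A a b ∧ not same)
    (cong₂ _∨_ (cong₂ _∧_ (isYes≗does (a ≟ x)) (isYes≗does (b ≟ y)))
               (cong₂ _∧_ (isYes≗does (a ≟ y)) (isYes≗does (b ≟ x))))

  removeEdge-⊆ : removeEdge A x y a b ≡ true → A a b ≡ true
  removeEdge-⊆ {a} {b} e = ∧-conicalˡ (A a b) _ (trans (≡-sym (removeEdge-unfold a b)) e)

  removeEdge-keeps : A a b ≡ true → ¬ SameEdge x y a b → removeEdge A x y a b ≡ true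
  removeEdge-keeps {a} {b} e other = trans (removeEdge-unfold a b)
    (cong₂ (λ p q → p ∧ not q) e (dec-false (sameEdge? x y a b) other))

  removeEdge-sym : (∀ a b → A a b ≡ A b a) → ∀ a b → removeEdge A x y a b ≡ removeEdge A x y b a
  removeEdge-sym A-sym a b = trans (removeEdge-unfold a b) (trans
    (cong₂ (λ p q → p ∧ not q) (A-sym a b)
      (does-⇔ SameEdge-swap (sameEdge? x y a b) (sameEdge? x y b a)))
    (≡-sym (removeEdge-unfold b a)))

  Walk-removeEdge⁻ : Walk (removeEdge A x y) u w → Walk A u w
  Walk-removeEdge⁻ []      = []
  Walk-removeEdge⁻ (e ∷ p) = removeEdge-⊆ e ∷ Walk-removeEdge⁻ p

  avoids-or-passes : (p : Walk A u w) → Walk (removeEdge A x y) u w ⊎ PassesThrough x p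
  avoids-or-passes []      = inj₁ []
  avoids-or-passes {u} (_∷_ {w = t} e p) with sameEdge? x y u t
  ... | yes (inj₁ (refl , _)) = inj₂ (passes [] (e ∷ p) refl)
  ... | yes (inj₂ (_ , refl)) = inj₂ (passes (e ∷ []) p refl)
  ... | no other = Sum.map (removeEdge-keeps e other ∷_) (PassesThrough-∷ e) (avoids-or-passes p)

  Walk-removeEdge⁺ : (p : Walk A u w) → ¬ PassesThrough x p → Walk (removeEdge A x y) u w
  Walk-removeEdge⁺ p avoids = [ id , (λ π → contradiction π avoids) ] (avoids-or-passes p)

  reroute : Walk (removeEdge A x y) x y → Walk (removeEdge A x y) y x →
    Walk A u w → Walk (removeEdge A x y) u w
  reroute x⇝y y⇝x []      = []
  reroute {u = u} x⇝y y⇝x (_∷_ {w = t} e p) with sameEdge? x y u t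
  ... | yes (inj₁ (refl , refl)) = x⇝y ++ reroute x⇝y y⇝x p
  ... | yes (inj₂ (refl , refl)) = y⇝x ++ reroute x⇝y y⇝x p
  ... | no other = removeEdge-keeps e other ∷ reroute x⇝y y⇝x p

shortest-avoids-other-edge : (va : A v a ≡ true) {p : Walk A a w} → IsShortest (va ∷ p) → b ≢ a →
  Walk (removeEdge A v b) v w
shortest-avoids-other-edge {A = A} {v} {a} {w} {b} va {p} shortest b≢a = va-kept ∷ p-kept
  where
  va-kept : removeEdge A v b v a ≡ true
  va-kept = removeEdge-keeps {A = A} {x = v} {y = b} va λ where
    (inj₁ (_ , a≡b))   → b≢a (≡-sym a≡b)
    (inj₂ (v≡b , a≡v)) → b≢a (≡-sym (trans a≡v v≡b))

  p-kept : Walk (removeEdge A v b) a w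
  p-kept = Walk-removeEdge⁺ p (shortest-suffix-avoids {s = va ∷ p} shortest (crossing [] p refl))

OnlyCutEdgesAt : Graph n → Fin n → Set
OnlyCutEdgesAt G v = ∀ b → adj G v b ≡ true → CutEdge G v b

module _ (G : Graph n) where

  Connected-isEquivalence : IsEquivalence (Connected (adj G))
  Connected-isEquivalence = record { refl = [] ; sym = reverse (Graph.sym G) ; trans = _++_ }

  reverse-removeEdge : Walk (removeEdge (adj G) x y) u w → Walk (removeEdge (adj G) x y) w u
  reverse-removeEdge = reverse (removeEdge-sym (Graph.sym G))

  Monitors-sym : Monitors G u w x y → Monitors G w u x y
  Monitors-sym (u↝w , on-shortest) = reverse (Graph.sym G) u↝w , λ s s-shortest →
    EdgeOn-reverse⁻ (Graph.sym G) s
      (on-shortest (reverse (Graph.sym G) s) (IsShortest-reverse (Graph.sym G) s-shortest))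

  Monitors-via : Walk (adj G) u v → (∀ (s : Walk (adj G) u w) → PassesThrough v s) →
    Monitors G v w x y → Monitors G u w x y
  Monitors-via u↝v through (v↝w , on-shortest) = u↝v ++ v↝w , λ s s-shortest →
    let π = through s in
    subst (EdgeOn _ _) (≡-sym (splits π))
      (EdgeOn-++⁺ʳ (before π) (on-shortest (after π) (IsShortest-after s-shortest π)))

  -- Component counts exist only up to double negation, which suffices to refute a detour.
  cut-edge-disconnects : CutEdge G x y → ¬ Walk (removeEdge (adj G) x y) y x
  cut-edge-disconnects (_ , more-components) y⇝x =
    classification Connected-isEquivalence λ (k , f , f-onto , f-classifies) →
      <-irrefl refl (more-components k k (f , f-onto , f-classifies) (f , f-onto , λ u w →
        (λ fu≡fw → reroute (reverse-removeEdge y⇝x) y⇝x (proj₁ (f-classifies u w) fu≡fw)) ,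
        (λ u⇝w → proj₂ (f-classifies u w) (Walk-removeEdge⁻ u⇝w))))

  endpoint-on-y-side : {s : Walk (adj G) c d} → IsShortest s → EdgeOn x y s →
    Walk (removeEdge (adj G) x y) y c ⊎ Walk (removeEdge (adj G) x y) y d
  endpoint-on-y-side s-shortest on with EdgeOn⇒Crossing on
  ... | inj₁ cr = inj₂ (Walk-removeEdge⁺ (suffix cr) (shortest-suffix-avoids s-shortest cr))
  ... | inj₂ cr =
    inj₁ (reverse-removeEdge (Walk-removeEdge⁺ (prefix cr) (shortest-prefix-avoids s-shortest cr)))

  Monitors-beyond-bridge : adj G v b ≡ true → ¬ Walk (removeEdge (adj G) v b) b v →
    Walk (removeEdge (adj G) v b) v w → Walk (removeEdge (adj G) v b) b u →
    Monitors G v w x y → Monitors G u w x y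
  Monitors-beyond-bridge {v = v} vb b↛v v⇝w b⇝u =
    Monitors-via (reverse (Graph.sym G) (vb ∷ Walk-removeEdge⁻ b⇝u)) through
    where
    through : ∀ s → PassesThrough v s
    through s = [ (λ u⇝w → contradiction (b⇝u ++ u⇝w ++ reverse-removeEdge v⇝w) b↛v) , id ]
                  (avoids-or-passes s)

  MEG-member-beyond-bridge : ∀ {M} → IsMEG G M → adj G v b ≡ true → CutEdge G v b →
    Walk (removeEdge (adj G) v b) v w → Monitors G v w x y →
    ∃ λ u → u ∈ M × u ≢ v × Monitors G u w x y
  MEG-member-beyond-bridge {v} {b} {w} {x} {y} {M} meg vb vb-cut v⇝w mon with meg v b vb
  ... | c , d , c∈M , d∈M , c↝d , vb-monitored with shortest-walk c↝d
  ... | s , s-shortest =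
    [ replace c∈M , replace d∈M ] (endpoint-on-y-side s-shortest (vb-monitored s s-shortest))
    where
    b↛v : ¬ Walk (removeEdge (adj G) v b) b v
    b↛v = cut-edge-disconnects vb-cut

    replace : ∀ {u} → u ∈ M → Walk (removeEdge (adj G) v b) b u →
      ∃ λ u → u ∈ M × u ≢ v × Monitors G u w x y
    replace u∈M b⇝u = _ , u∈M , (λ { refl → b↛v b⇝u }) , Monitors-beyond-bridge vb b↛v v⇝w b⇝u mon

  MEG-member-replacing-cut-vertex : ∀ {M} → IsMEG G M → degree G v ≢ 1 → OnlyCutEdgesAt G v →
    Monitors G v w x y → ∃ λ u → u ∈ M × u ≢ v × Monitors G u w x y
  MEG-member-replacing-cut-vertex {v} meg deg≢1 cut mon@(v↝w , on-shortest) with shortest-walk v↝w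
  ... | [] , shortest = contradiction (on-shortest [] shortest) λ ()
  ... | va ∷ p , shortest with ∣tabulate∣≢1⇒another (adj G v) deg≢1 va
  ...   | b , vb , b≢a =
    MEG-member-beyond-bridge meg vb (cut b vb) (shortest-avoids-other-edge va shortest b≢a) mon

  IsMEG-remove-cut-vertex : ∀ {M} → IsMEG G M → degree G v ≢ 1 → OnlyCutEdgesAt G v → IsMEG G (M - v)
  IsMEG-remove-cut-vertex {v} {M} meg deg≢1 cut x y xy =
    let u , w , u∈M , w∈M , mon = meg x y xy
        u′ , u′∈ , mon₁ = replace u∈M mon
        w′ , w′∈ , mon₂ = replace w∈M (Monitors-sym mon₁)
    in u′ , w′ , u′∈ , w′∈ , Monitors-sym mon₂
    where
    replace : ∀ {u w} → u ∈ M → Monitors G u w x y → ∃ λ u′ → u′ ∈ M - v × Monitors G u′ w x y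
    replace {u} u∈M mon with u ≟ v
    ... | no u≢v   = u , x∈p∧x≢y⇒x∈p-y u∈M u≢v , mon
    ... | yes refl =
      let u′ , u′∈M , u′≢v , mon′ = MEG-member-replacing-cut-vertex meg deg≢1 cut mon
      in u′ , x∈p∧x≢y⇒x∈p-y u′∈M u′≢v , mon′

mainTheorem17 : ∀ {n} (G : Graph n) (H : Subset n) →
    InducedConnected G H →
    (∀ x y → adj G x y ≡ true → x ∈ H ⊎ y ∈ H → CutEdge G x y) →
    ∀ v → v ∈ H → degree G v ≡ 1 ⊎ (∀ M → IsMinimumMEG G M → v ∉ M)
mainTheorem17 G H _ cut-at-H v v∈H with degree G v ≟ℕ 1
... | yes deg≡1 = inj₁ deg≡1
... | no deg≢1 = inj₂ λ M (meg , minimum) v∈M →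
  <⇒≱ (x∈p⇒∣p-x∣<∣p∣ v∈M) (minimum (M - v) (IsMEG-remove-cut-vertex G meg deg≢1 cut-at-v))
  where
  cut-at-v : OnlyCutEdgesAt G v
  cut-at-v b vb = cut-at-H v b vb (inj₁ v∈H)
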